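{- Let $A$ be an fMV-algebra in which the internal product is commutative. Then $x\cdot y=(x\wedge y)\cdot(x\vee y)$ for all $x,y\in A$.
   Context: An fMV-algebra is a structure $(A,\oplus,\cdot,{}^*,\{\alpha\}_{\alpha\in[0,1]},0)$ where $(A,\oplus,{}^*,0)$ is an MV-algebra (with $x\odot y=(x^*\oplus y^*)^*$, order $x\le y$ iff $x\odot y^*=0$, a lattice order with $x\vee y=(x\odot y^*)\oplus y$ and $x\wedge y=x\odot(x^*\oplus y)$), $\cdot$ is an associative binary operation and $x\mapsto\alpha x$ are unary operations satisfying: $z\cdot(x\odot(x\wedge y)^*)=(z\cdot x)\odot(z\cdot(x\wedge y))^*$, $(x\odot(x\wedge y)^*)\cdot z=(x\cdot z)\odot((x\wedge y)\cdot z)^*$, $x\wedge y=0\Rightarrow(x\cdot z)\wedge y=(z\cdot x)\wedge y=0$, $\alpha(x\odot y^*)=(\alpha x)\odot(\alpha y)^*$, $\max(0,\alpha-\beta)x=(\alpha x)\odot(\beta x)^*$, $\alpha(\beta x)=(\alpha\beta)x$, $1x=x$, $\alpha(x\cdot y)=(\alpha x)\cdot y=x\cdot(\alpha y)$. -}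

module Defs where

open import Level using (Level; suc; _⊔_)
open import Relation.Binary.PropositionalEquality using (_≡_)
open import Data.Rational as ℚ using (ℚ; 0ℚ; 1ℚ)
open import Data.Product using (Σ; _×_; proj₁)

-- Scalars α ∈ [0,1]. The paper uses real numbers; the standard library has no
-- reals, so we use the rational unit interval.
I : Set
I = Σ ℚ (λ α → (0ℚ ℚ.≤ α) × (α ℚ.≤ 1ℚ))

val : I → ℚ
val = proj₁

record IsMV {a} (A : Set a) (_⊕_ : A → A → A) (_* : A → A) (𝟘 : A) : Set a where
  field
    ⊕-assoc : ∀ x y z → (x ⊕ y) ⊕ z ≡ x ⊕ (y ⊕ z)
    ⊕-comm  : ∀ x y → x ⊕ y ≡ y ⊕ x
    ⊕-identity : ∀ x → x ⊕ 𝟘 ≡ x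
    involutive : ∀ x → (x *) * ≡ x
    absorbing : ∀ x → x ⊕ (𝟘 *) ≡ 𝟘 *
    łukasiewicz : ∀ x y → (((x *) ⊕ y) *) ⊕ y ≡ (((y *) ⊕ x) *) ⊕ x

  infixl 7 _⊙_
  _⊙_ : A → A → A
  x ⊙ y = ((x *) ⊕ (y *)) *

  infixl 6 _∨_ _∧_
  _∨_ : A → A → A
  x ∨ y = (x ⊙ (y *)) ⊕ y

  _∧_ : A → A → A
  x ∧ y = x ⊙ ((x *) ⊕ y)

record FMVAlgebra a : Set (suc a) where
  infixl 6 _⊕_
  infixl 8 _·_
  infixr 9 _•_
  field
    Carrier : Set a
    _⊕_ : Carrier → Carrier → Carrier
    _·_ : Carrier → Carrier → Carrier
    _* : Carrier → Carrier
    _•_ : I → Carrier → Carrier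
    𝟘 : Carrier
    isMV : IsMV Carrier _⊕_ _* 𝟘

  open IsMV isMV public

  field
    ·-assoc : ∀ x y z → (x · y) · z ≡ x · (y · z)
    ·-distribˡ : ∀ x y z → z · (x ⊙ ((x ∧ y) *)) ≡ (z · x) ⊙ ((z · (x ∧ y)) *)
    ·-distribʳ : ∀ x y z → (x ⊙ ((x ∧ y) *)) · z ≡ (x · z) ⊙ (((x ∧ y) · z) *)
    ·-orth : ∀ x y z → x ∧ y ≡ 𝟘 → ((x · z) ∧ y ≡ 𝟘) × ((z · x) ∧ y ≡ 𝟘)
    •-diff : ∀ α x y → α • (x ⊙ (y *)) ≡ (α • x) ⊙ ((α • y) *)
    •-sub : ∀ (α β γ : I) x → val γ ≡ (val α ℚ.- val β) ℚ.⊔ 0ℚ →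
      γ • x ≡ (α • x) ⊙ ((β • x) *)
    •-mul : ∀ (α β γ : I) x → val γ ≡ val α ℚ.* val β → α • (β • x) ≡ γ • x
    •-one : ∀ (α : I) x → val α ≡ 1ℚ → α • x ≡ x
    •-·ˡ : ∀ α x y → α • (x · y) ≡ (α • x) · y
    •-·ʳ : ∀ α x y → α • (x · y) ≡ x · (α • y)

module Submission where

-- Write m = x ∧ y, a = x ⊖ y and b = y ⊖ x, where u ⊖ v = u ⊙ v*.
-- In every MV-algebra x = m ⊕ a, (x ∨ y) ⊖ x = b and a ∧ b = 0
-- (prelinearity).  The distributivity axioms of an fMV-algebra say that z · _
-- and _ · z preserve truncated differences, and every such map f splits as
-- f u = f (u ∧ w) ⊕ f (u ⊖ w).  The orthogonality axiom gives a · b = 0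
-- whenever a ∧ b = 0.  Expanding both sides with these facts,
--   x · y             = m · y ⊕ a · y = (m · m ⊕ m · b) ⊕ a · m,
--   (x ∧ y) · (x ∨ y) = m · x ⊕ m · b = (m · m ⊕ m · a) ⊕ m · b,
-- and the two agree because a · m = m · a.

open import Defs
open import Relation.Binary.PropositionalEquality
  using (_≡_; refl; sym; trans; cong; cong₂; subst; subst₂; module ≡-Reasoning)
open import Data.Product using (proj₁; proj₂)

module MVProperties {a} {A : Set a} {_⊕_ : A → A → A} {_* : A → A} {𝟘 : A}
                    (mv : IsMV A _⊕_ _* 𝟘) where
  open IsMV mv
  open ≡-Reasoning

  infix 4 _≤_

  𝟙 : A
  𝟙 = 𝟘 *

  -- Truncated difference; in the standard algebra [0,1] it is max(0, u − v).
  _⊖_ : A → A → A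
  u ⊖ v = u ⊙ (v *)

  -- The natural order of an MV-algebra (equivalent to u ⊙ v* = 0).
  _≤_ : A → A → Set a
  u ≤ v = (u *) ⊕ v ≡ 𝟙

  ⊕-identityˡ : ∀ x → 𝟘 ⊕ x ≡ x
  ⊕-identityˡ x = trans (⊕-comm 𝟘 x) (⊕-identity x)

  ⊕-absorbingˡ : ∀ x → 𝟙 ⊕ x ≡ 𝟙
  ⊕-absorbingˡ x = trans (⊕-comm 𝟙 x) (absorbing x)

  𝟙*≡𝟘 : 𝟙 * ≡ 𝟘
  𝟙*≡𝟘 = involutive 𝟘

  -- x* ⊕ x = 1, obtained from the Łukasiewicz axiom with y = 1.
  ⊕-inverseˡ : ∀ x → (x *) ⊕ x ≡ 𝟙
  ⊕-inverseˡ x = begin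
    (x *) ⊕ x                 ≡⟨ cong (λ t → (t *) ⊕ x) 𝟙*⊕x≡x ⟨
    (((𝟙 *) ⊕ x) *) ⊕ x       ≡⟨ łukasiewicz x 𝟙 ⟨
    (((x *) ⊕ 𝟙) *) ⊕ 𝟙       ≡⟨ cong (λ t → (t *) ⊕ 𝟙) (absorbing (x *)) ⟩
    (𝟙 *) ⊕ 𝟙                 ≡⟨ cong (_⊕ 𝟙) 𝟙*≡𝟘 ⟩
    𝟘 ⊕ 𝟙                     ≡⟨ ⊕-identityˡ 𝟙 ⟩
    𝟙                         ∎
    where
    𝟙*⊕x≡x : (𝟙 *) ⊕ x ≡ x
    𝟙*⊕x≡x = trans (cong (_⊕ x) 𝟙*≡𝟘) (⊕-identityˡ x)

  ⊕-swapʳ : ∀ p q r → (p ⊕ q) ⊕ r ≡ (p ⊕ r) ⊕ q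
  ⊕-swapʳ p q r = begin
    (p ⊕ q) ⊕ r   ≡⟨ ⊕-assoc p q r ⟩
    p ⊕ (q ⊕ r)   ≡⟨ cong (p ⊕_) (⊕-comm q r) ⟩
    p ⊕ (r ⊕ q)   ≡⟨ ⊕-assoc p r q ⟨
    (p ⊕ r) ⊕ q   ∎

  ⊙-comm : ∀ u v → u ⊙ v ≡ v ⊙ u
  ⊙-comm u v = cong _* (⊕-comm (u *) (v *))

  ∨-łukasiewicz : ∀ p q → p ∨ q ≡ (((p *) ⊕ q) *) ⊕ q
  ∨-łukasiewicz p q = cong (λ t → (((p *) ⊕ t) *) ⊕ q) (involutive q)

  ∨-comm : ∀ p q → p ∨ q ≡ q ∨ p
  ∨-comm p q = begin
    p ∨ q                     ≡⟨ ∨-łukasiewicz p q ⟩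
    (((p *) ⊕ q) *) ⊕ q       ≡⟨ łukasiewicz p q ⟩
    (((q *) ⊕ p) *) ⊕ p       ≡⟨ ∨-łukasiewicz q p ⟨
    q ∨ p                     ∎

  ∧-dual : ∀ u w → (u ∧ w) * ≡ (u *) ∨ (w *)
  ∧-dual u w = begin
    (u ∧ w) *                              ≡⟨ involutive _ ⟩
    (u *) ⊕ (((u *) ⊕ w) *)                ≡⟨ ⊕-comm (u *) _ ⟩
    (((u *) ⊕ w) *) ⊕ (u *)                ≡⟨ cong (λ t → (t *) ⊕ (u *)) u*⊕w≡w**⊕u* ⟩
    ((((w *) *) ⊕ (u *)) *) ⊕ (u *)        ≡⟨ łukasiewicz (u *) (w *) ⟨
    ((((u *) *) ⊕ (w *)) *) ⊕ (w *)        ≡⟨ ∨-łukasiewicz (u *) (w *) ⟨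
    (u *) ∨ (w *)                          ∎
    where
    u*⊕w≡w**⊕u* : (u *) ⊕ w ≡ ((w *) *) ⊕ (u *)
    u*⊕w≡w**⊕u* = trans (⊕-comm (u *) w) (cong (_⊕ (u *)) (sym (involutive w)))

  ∧-via-∨ : ∀ u w → u ∧ w ≡ ((u *) ∨ (w *)) *
  ∧-via-∨ u w = trans (sym (involutive (u ∧ w))) (cong _* (∧-dual u w))

  ∧-comm : ∀ u w → u ∧ w ≡ w ∧ u
  ∧-comm u w = trans (∧-via-∨ u w) (trans (cong _* (∨-comm (u *) (w *))) (sym (∧-via-∨ w u)))

  ≤-refl : ∀ u → u ≤ u
  ≤-refl = ⊕-inverseˡ

  ≤-of-⊕ : ∀ {u v} r → v ≡ u ⊕ r → u ≤ v
  ≤-of-⊕ {u} r refl = begin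
    (u *) ⊕ (u ⊕ r)   ≡⟨ ⊕-assoc (u *) u r ⟨
    ((u *) ⊕ u) ⊕ r   ≡⟨ cong (_⊕ r) (⊕-inverseˡ u) ⟩
    𝟙 ⊕ r             ≡⟨ ⊕-absorbingˡ r ⟩
    𝟙                 ∎

  ≤⇒∨≡ : ∀ {p q} → p ≤ q → p ∨ q ≡ q
  ≤⇒∨≡ {p} {q} p≤q = begin
    p ∨ q                 ≡⟨ ∨-łukasiewicz p q ⟩
    (((p *) ⊕ q) *) ⊕ q   ≡⟨ cong (λ t → (t *) ⊕ q) p≤q ⟩
    (𝟙 *) ⊕ q             ≡⟨ cong (_⊕ q) 𝟙*≡𝟘 ⟩
    𝟘 ⊕ q                 ≡⟨ ⊕-identityˡ q ⟩
    q                     ∎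

  ≤⇒split : ∀ {p q} → p ≤ q → q ≡ p ⊕ (q ⊖ p)
  ≤⇒split {p} {q} p≤q = begin
    q                 ≡⟨ ≤⇒∨≡ p≤q ⟨
    p ∨ q             ≡⟨ ∨-comm p q ⟩
    (q ⊖ p) ⊕ p       ≡⟨ ⊕-comm (q ⊖ p) p ⟩
    p ⊕ (q ⊖ p)       ∎

  ≤-antisym : ∀ {p q} → p ≤ q → q ≤ p → p ≡ q
  ≤-antisym {p} {q} p≤q q≤p = trans (sym (≤⇒∨≡ q≤p)) (trans (∨-comm q p) (≤⇒∨≡ p≤q))

  ≤-trans : ∀ {p q r} → p ≤ q → q ≤ r → p ≤ r
  ≤-trans {p} {q} {r} p≤q q≤r = ≤-of-⊕ ((q ⊖ p) ⊕ (r ⊖ q)) (begin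
    r                             ≡⟨ ≤⇒split q≤r ⟩
    q ⊕ (r ⊖ q)                   ≡⟨ cong (_⊕ (r ⊖ q)) (≤⇒split p≤q) ⟩
    (p ⊕ (q ⊖ p)) ⊕ (r ⊖ q)       ≡⟨ ⊕-assoc p (q ⊖ p) (r ⊖ q) ⟩
    p ⊕ ((q ⊖ p) ⊕ (r ⊖ q))       ∎)

  ⊕-monoˡ : ∀ d {p q} → p ≤ q → (d ⊕ p) ≤ (d ⊕ q)
  ⊕-monoˡ d {p} {q} p≤q = ≤-of-⊕ (q ⊖ p)
    (trans (cong (d ⊕_) (≤⇒split p≤q)) (sym (⊕-assoc d p (q ⊖ p))))

  ⊕-monoʳ : ∀ d {p q} → p ≤ q → (p ⊕ d) ≤ (q ⊕ d)
  ⊕-monoʳ d {p} {q} p≤q = subst₂ _≤_ (⊕-comm d p) (⊕-comm d q) (⊕-monoˡ d p≤q)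

  *-antitone : ∀ {p q} → p ≤ q → (q *) ≤ (p *)
  *-antitone {p} {q} p≤q = trans (cong (_⊕ (p *)) (involutive q)) (trans (⊕-comm q (p *)) p≤q)

  ⊙-monoʳ : ∀ d {p q} → p ≤ q → (p ⊙ d) ≤ (q ⊙ d)
  ⊙-monoʳ d p≤q = *-antitone (⊕-monoʳ (d *) (*-antitone p≤q))

  ⊙-lowerʳ : ∀ u v → (u ⊙ v) ≤ v
  ⊙-lowerʳ u v = begin
    ((u ⊙ v) *) ⊕ v           ≡⟨ cong (_⊕ v) (involutive _) ⟩
    ((u *) ⊕ (v *)) ⊕ v       ≡⟨ ⊕-assoc (u *) (v *) v ⟩
    (u *) ⊕ ((v *) ⊕ v)       ≡⟨ cong ((u *) ⊕_) (⊕-inverseˡ v) ⟩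
    (u *) ⊕ 𝟙                 ≡⟨ absorbing (u *) ⟩
    𝟙                         ∎

  ⊙-lowerˡ : ∀ u v → (u ⊙ v) ≤ u
  ⊙-lowerˡ u v = subst (_≤ u) (⊙-comm v u) (⊙-lowerʳ v u)

  ≤-∨ : ∀ x y → x ≤ (x ∨ y)
  ≤-∨ x y = ≤-of-⊕ (y ⊖ x) (trans (∨-comm x y) (⊕-comm (y ⊖ x) x))

  ∨-lub : ∀ {p q c} → p ≤ c → q ≤ c → (p ∨ q) ≤ c
  ∨-lub {p} {q} {c} p≤c q≤c =
    subst ((p ∨ q) ≤_) (trans (∨-comm c q) (≤⇒∨≡ q≤c)) (⊕-monoʳ q (⊙-monoʳ (q *) p≤c))

  ∧-lowerˡ : ∀ u w → (u ∧ w) ≤ u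
  ∧-lowerˡ u w = ⊙-lowerˡ u _

  ∧-lowerʳ : ∀ u w → (u ∧ w) ≤ w
  ∧-lowerʳ u w = subst (_≤ w) (∧-comm w u) (∧-lowerˡ w u)

  ∧-glb : ∀ {c p q} → c ≤ p → c ≤ q → c ≤ (p ∧ q)
  ∧-glb {c} {p} {q} c≤p c≤q = subst₂ _≤_ (involutive c) (sym (∧-via-∨ p q))
    (*-antitone (∨-lub (*-antitone c≤p) (*-antitone c≤q)))

  ≤⇒∧≡ : ∀ {p u} → p ≤ u → u ∧ p ≡ p
  ≤⇒∧≡ {p} {u} p≤u = trans (∧-via-∨ u p) (trans (cong _* (≤⇒∨≡ (*-antitone p≤u))) (involutive p))

  ∧-idem : ∀ u → u ∧ u ≡ u
  ∧-idem u = ≤⇒∧≡ (≤-refl u)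

  ⊖-lower : ∀ u v → (u ⊖ v) ≤ u
  ⊖-lower u v = ⊙-lowerˡ u (v *)

  ⊖-below-complement : ∀ u v → (u ⊖ v) ≤ (v *)
  ⊖-below-complement u v = ⊙-lowerʳ u (v *)

  ⊖⊖ : ∀ u v → u ⊖ (u ⊖ v) ≡ u ∧ v
  ⊖⊖ u v = cong (λ t → ((u *) ⊕ t) *)
    (trans (involutive (u ⊖ v)) (cong (λ s → ((u *) ⊕ s) *) (involutive v)))

  ⊖-∧ : ∀ u w → u ⊖ (u ∧ w) ≡ u ⊖ w
  ⊖-∧ u w = begin
    u ⊖ (u ∧ w)               ≡⟨ cong (u ⊖_) (⊖⊖ u w) ⟨
    u ⊖ (u ⊖ (u ⊖ w))         ≡⟨ ⊖⊖ u (u ⊖ w) ⟩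
    u ∧ (u ⊖ w)               ≡⟨ ≤⇒∧≡ (⊖-lower u w) ⟩
    u ⊖ w                     ∎

  ⊕⊖ : ∀ b x → (b ⊕ x) ⊖ x ≡ (x *) ∧ b
  ⊕⊖ b x = cong _* (trans (⊕-comm ((b ⊕ x) *) ((x *) *))
    (cong (λ s → ((x *) *) ⊕ (s *)) (trans (⊕-comm b x) (cong (_⊕ b) (sym (involutive x))))))

  ∨-⊖ : ∀ x y → (x ∨ y) ⊖ x ≡ y ⊖ x
  ∨-⊖ x y = begin
    (x ∨ y) ⊖ x               ≡⟨ cong (_⊖ x) (∨-comm x y) ⟩
    ((y ⊖ x) ⊕ x) ⊖ x         ≡⟨ ⊕⊖ (y ⊖ x) x ⟩
    (x *) ∧ (y ⊖ x)           ≡⟨ ≤⇒∧≡ (⊖-below-complement y x) ⟩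
    y ⊖ x                     ∎

  ∧⊕⊖ : ∀ x y → x ≡ (x ∧ y) ⊕ (x ⊖ y)
  ∧⊕⊖ x y = trans (≤⇒split (∧-lowerˡ x y)) (cong ((x ∧ y) ⊕_) (⊖-∧ x y))

  absorbed-below-complement : ∀ {m z} → m ⊕ z ≡ m → z ≤ (m *) → z ≡ 𝟘
  absorbed-below-complement {m} {z} m⊕z≡m z≤m* = begin
    z                         ≡⟨ ≤⇒∧≡ z≤m* ⟨
    (m *) ∧ z                 ≡⟨ cong (λ t → (m *) ⊙ (t ⊕ z)) (involutive m) ⟩
    (m *) ⊙ (m ⊕ z)           ≡⟨ cong ((m *) ⊙_) m⊕z≡m ⟩
    (m *) ⊙ m                 ≡⟨ cong _* (⊕-inverseˡ (m *)) ⟩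
    𝟙 *                       ≡⟨ 𝟙*≡𝟘 ⟩
    𝟘                         ∎

  prelinearity : ∀ x y → (x ⊖ y) ∧ (y ⊖ x) ≡ 𝟘
  prelinearity x y = absorbed-below-complement m⊕z≡m z≤m*
    where
    m = x ∧ y
    z = (x ⊖ y) ∧ (y ⊖ x)
    -- m ⊕ z is a lower bound of x = m ⊕ (x ⊖ y) and y = m ⊕ (y ⊖ x), hence of m.
    m⊕z≤x : (m ⊕ z) ≤ x
    m⊕z≤x = subst ((m ⊕ z) ≤_) (sym (∧⊕⊖ x y)) (⊕-monoˡ m (∧-lowerˡ _ _))
    m⊕z≤y : (m ⊕ z) ≤ y
    m⊕z≤y = subst ((m ⊕ z) ≤_) (sym (trans (∧⊕⊖ y x) (cong (_⊕ (y ⊖ x)) (∧-comm y x))))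
                  (⊕-monoˡ m (∧-lowerʳ _ _))
    m⊕z≡m : m ⊕ z ≡ m
    m⊕z≡m = ≤-antisym (∧-glb m⊕z≤x m⊕z≤y) (≤-of-⊕ z refl)
    z≤m* : z ≤ (m *)
    z≤m* = ≤-trans (∧-lowerˡ _ _)
             (≤-trans (⊖-below-complement x y) (*-antitone (∧-lowerʳ x y)))

  PreservesDifferences : (A → A) → Set a
  PreservesDifferences f = ∀ u w → f (u ⊖ (u ∧ w)) ≡ f u ⊖ f (u ∧ w)

  module _ {f : A → A} (f-⊖ : PreservesDifferences f) where

    preserves-⊖ : ∀ {v u} → v ≤ u → f (u ⊖ v) ≡ f u ⊖ f v
    preserves-⊖ {v} {u} v≤u = begin
      f (u ⊖ v)               ≡⟨ cong (λ t → f (u ⊖ t)) (≤⇒∧≡ v≤u) ⟨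
      f (u ⊖ (u ∧ v))         ≡⟨ f-⊖ u v ⟩
      f u ⊖ f (u ∧ v)         ≡⟨ cong (λ t → f u ⊖ f t) (≤⇒∧≡ v≤u) ⟩
      f u ⊖ f v               ∎

    -- Monotonicity: f v = f u ⊖ (f u ⊖ f v) = f u ∧ f v.
    monotone : ∀ {v u} → v ≤ u → f v ≤ f u
    monotone {v} {u} v≤u = subst (_≤ f u) fv≡fu∧fv (∧-lowerˡ (f u) (f v))
      where
      fv≡fu∧fv : f u ∧ f v ≡ f v
      fv≡fu∧fv = sym (begin
        f v                       ≡⟨ cong f (trans (⊖⊖ u v) (≤⇒∧≡ v≤u)) ⟨
        f (u ⊖ (u ⊖ v))           ≡⟨ preserves-⊖ (⊖-lower u v) ⟩
        f u ⊖ f (u ⊖ v)           ≡⟨ cong (f u ⊖_) (preserves-⊖ v≤u) ⟩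
        f u ⊖ (f u ⊖ f v)         ≡⟨ ⊖⊖ (f u) (f v) ⟩
        f u ∧ f v                 ∎)

    split : ∀ u w → f u ≡ f (u ∧ w) ⊕ f (u ⊖ w)
    split u w = begin
      f u                             ≡⟨ ≤⇒split (monotone (∧-lowerˡ u w)) ⟩
      f (u ∧ w) ⊕ (f u ⊖ f (u ∧ w))   ≡⟨ cong (f (u ∧ w) ⊕_) (f-⊖ u w) ⟨
      f (u ∧ w) ⊕ f (u ⊖ (u ∧ w))     ≡⟨ cong (λ t → f (u ∧ w) ⊕ f t) (⊖-∧ u w) ⟩
      f (u ∧ w) ⊕ f (u ⊖ w)           ∎

module FMVProperties {a} (A : FMVAlgebra a) where
  open FMVAlgebra A
  open MVProperties isMV

  ·-preservesˡ : ∀ z → PreservesDifferences (z ·_)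
  ·-preservesˡ z u w = ·-distribˡ u w z

  ·-preservesʳ : ∀ z → PreservesDifferences (_· z)
  ·-preservesʳ z u w = ·-distribʳ u w z

  -- Orthogonal elements annihilate: from a ∧ b = 0 the orthogonality axiom
  -- gives b ∧ (a · b) = 0 and then (a · b) ∧ (a · b) = 0.
  orthogonal⇒annihilate : ∀ {x y} → x ∧ y ≡ 𝟘 → x · y ≡ 𝟘
  orthogonal⇒annihilate {x} {y} x∧y≡0 =
    trans (sym (∧-idem (x · y))) (proj₂ (·-orth y (x · y) x y∧xy≡0))
    where
    y∧xy≡0 : y ∧ (x · y) ≡ 𝟘
    y∧xy≡0 = trans (∧-comm y (x · y)) (proj₁ (·-orth x y y x∧y≡0))

corollary2p12 : ∀ {a} (A : FMVAlgebra a) → let open FMVAlgebra A in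
    (∀ x y → x · y ≡ y · x) → ∀ x y → x · y ≡ (x ∧ y) · (x ∨ y)
corollary2p12 A ·-comm x y = begin
    x · y                             ≡⟨ split (·-preservesʳ y) x y ⟩
    m · y ⊕ a · y                     ≡⟨ cong₂ _⊕_ m·y≡ a·y≡ ⟩
    m · m ⊕ m · b ⊕ m · a             ≡⟨ ⊕-swapʳ (m · m) (m · b) (m · a) ⟩
    m · m ⊕ m · a ⊕ m · b             ≡⟨ cong₂ _⊕_ (split (·-preservesˡ m) x y) (cong (m ·_) (∨-⊖ x y)) ⟨
    m · x ⊕ m · (j ⊖ x)               ≡⟨ cong (λ t → m · t ⊕ m · (j ⊖ x)) (≤⇒∧≡ (≤-∨ x y)) ⟨
    m · (j ∧ x) ⊕ m · (j ⊖ x)         ≡⟨ split (·-preservesˡ m) j x ⟨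
    m · j                             ∎
  where
  open FMVAlgebra A
  open MVProperties isMV
  open FMVProperties A
  open ≡-Reasoning
  m = x ∧ y
  a = x ⊖ y
  b = y ⊖ x
  j = x ∨ y
  m·y≡ : m · y ≡ m · m ⊕ m · b
  m·y≡ = trans (split (·-preservesˡ m) y x) (cong (λ t → m · t ⊕ m · b) (∧-comm y x))
  -- a · y = a · m ⊕ a · b, where a · b = 0 by prelinearity.
  a·y≡ : a · y ≡ m · a
  a·y≡ = begin
    a · y                 ≡⟨ split (·-preservesˡ a) y x ⟩
    a · (y ∧ x) ⊕ a · b   ≡⟨ cong₂ (λ t s → a · t ⊕ s) (∧-comm y x) (orthogonal⇒annihilate (prelinearity x y)) ⟩
    a · m ⊕ 𝟘             ≡⟨ ⊕-identity (a · m) ⟩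
    a · m                 ≡⟨ ·-comm a m ⟩
    m · a                 ∎
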